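{- Let $k\ge1$, let $A$ be a $k\times k$ strictly upper triangular matrix of integers, and suppose every integer sequence $\lambda=(\lambda_1,\ldots,\lambda_k)$ with $\lambda_i \ge \sum_{j=i+1}^{k} A[i,j]\lambda_j$ for all $1\le i\le k$ has all entries nonnegative. Let $S\subseteq\{1,\ldots,k\}$ and let $d_1,\ldots,d_k$ be nonnegative integers. Let $D_A(n,k;S)$ be the set of sequences $\lambda=(\lambda_1,\ldots,\lambda_k)$ of nonnegative integers of weight $n$ satisfying, for $1\le i\le k$, \[\lambda_i=\sum_{j=i+1}^k A[i,j]\lambda_j+d_i \ \text{ if } i\in S,\qquad \lambda_i\ge\sum_{j=i+1}^k A[i,j]\lambda_j+d_i\ \text{ if } i\notin S,\] and let $P_A(n,k;S)$ be the analogous set with all $d_i=0$ (i.e. integer sequences of weight $n$ with $\lambda_i=\sum_{j>i}A[i,j]\lambda_j$ for $i\in S$ and $\lambda_i\ge\sum_{j>i}A[i,j]\lambda_j$ for $i\notin S$). Then \[\sum_{n\ge0}|D_A(n,k;S)|\,q^n=\prod_{i=1}^k q^{d_ib_i}\sum_{n=0}^\infty |P_A(n,k;S)|\,q^n,\] where $b_i=\sum_j B[j,i]$ is the $i$-th column sum of $B=(I-A)^{ -1}$.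
   Context: A strictly upper triangular matrix $A$ has $A[i,j]=0$ for $i\ge j$; the weight of a sequence is the sum of its entries. -}

module Defs where

open import Data.Nat as ℕ using (ℕ; zero; suc)
open import Data.Fin using (Fin; toℕ)
open import Data.Vec using (Vec; lookup)
open import Data.Bool using (Bool; true; false; if_then_else_)
open import Data.Integer using (ℤ; +_; _+_; _*_; _-_; _≤_; 0ℤ; 1ℤ)
open import Data.List using (List; length)
open import Data.List.Relation.Unary.Unique.Propositional using (Unique)
open import Data.List.Membership.Propositional using (_∈_)
open import Data.Product using (Σ; _×_)
open import Function.Bundles using (_⇔_)
open import Relation.Binary.PropositionalEquality using (_≡_)

-- k × k integer matrices, indices 0..k-1 (paper's 1..k shifted by one)
Matrix : ℕ → Set
Matrix k = Fin k → Fin k → ℤ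

ΣFin : ∀ {k} → (Fin k → ℤ) → ℤ
ΣFin {zero} f = 0ℤ
ΣFin {suc k} f = f Fin.zero + ΣFin (λ i → f (Fin.suc i))

StrictlyUpper : ∀ {k} → Matrix k → Set
StrictlyUpper A = ∀ i j → toℕ j ℕ.≤ toℕ i → A i j ≡ 0ℤ

weight : ∀ {k} → Vec ℤ k → ℤ
weight l = ΣFin (lookup l)

tailSum : ∀ {k} → Matrix k → Vec ℤ k → Fin k → ℤ
tailSum A l i = ΣFin (λ j → if toℕ i ℕ.<ᵇ toℕ j then A i j * lookup l j else 0ℤ)

Cond : Bool → ℤ → ℤ → Set
Cond true x y = x ≡ y
Cond false x y = y ≤ x

δ : ∀ {k} → Fin k → Fin k → ℤ
δ i j = if toℕ i ℕ.≡ᵇ toℕ j then 1ℤ else 0ℤ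

IminusA : ∀ {k} → Matrix k → Matrix k
IminusA A i j = δ i j - A i j

_·_ : ∀ {k} → Matrix k → Matrix k → Matrix k
(M · N) i j = ΣFin (λ l → M i l * N l j)

IsInverseOf : ∀ {k} → Matrix k → Matrix k → Set
IsInverseOf B M = (∀ i j → (M · B) i j ≡ δ i j) × (∀ i j → (B · M) i j ≡ δ i j)

colSum : ∀ {k} → Matrix k → Fin k → ℤ
colSum B i = ΣFin (λ j → B j i)

-- D_A(n,k;S) membership (S as a Vec Bool = Data.Fin.Subset)
InD : ∀ {k} → Matrix k → Vec Bool k → (Fin k → ℕ) → ℕ → Vec ℤ k → Set
InD A S d n l =
  weight l ≡ + n
  × (∀ i → 0ℤ ≤ lookup l i)
  × (∀ i → Cond (lookup S i) (lookup l i) (tailSum A l i + + d i))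

InP : ∀ {k} → Matrix k → Vec Bool k → ℤ → Vec ℤ k → Set
InP A S w l =
  weight l ≡ w
  × (∀ i → Cond (lookup S i) (lookup l i) (tailSum A l i))

HasCard : ∀ {k} → (Vec ℤ k → Set) → ℕ → Set
HasCard {k} P m =
  Σ (List (Vec ℤ k)) λ xs → length xs ≡ m × Unique xs × (∀ v → P v ⇔ (v ∈ xs))

shift : ∀ {k} → (Fin k → ℕ) → Matrix k → ℤ
shift d B = ΣFin (λ i → + d i * colSum B i)

-- Let c = B d, the solution of (I - A) c = d.  As c_i = Σ_{j>i} A[i,j] c_j + d_i,
-- the translation μ ↦ μ + c turns each constraint of P_A into the corresponding
-- constraint of D_A and raises the weight by Σ_i c_i = Σ_i d_i b_i; the translates
-- are nonnegative by the hypothesis on A.  So it maps P_A(n - Σ_i d_i b_i, k; S)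
-- bijectively onto D_A(n, k; S), which is finite as it lies in the box [0, n]^k.
module Submission where

open import Defs
open import Data.Nat as ℕ using (ℕ; _≤_; zero; suc; s≤s)
import Data.Nat.Properties as ℕP
open import Data.Fin using (Fin; toℕ; zero; suc)
open import Data.Fin.Subset using (Subset)
import Data.Fin.Properties as FinP
open import Data.Vec using (Vec; []; _∷_; lookup; zipWith; tabulate)
import Data.Vec.Properties as VecP
open import Data.Integer using (ℤ; +_; -[1+_]; _+_; _-_; _*_; -_; 0ℤ; 1ℤ; +≤+)
  renaming (_≤_ to _≤ℤ_)
import Data.Integer.Properties as ℤP
open import Data.Bool using (Bool; true; false; T; if_then_else_)
import Data.List as List
open import Data.List using (List; length; map; filter; upTo; deduplicate; cartesianProductWith)
import Data.List.Properties as ListP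
open import Data.List.Membership.Propositional using (_∈_)
open import Data.List.Membership.Propositional.Properties
open import Data.List.Relation.Unary.Any using (here)
import Data.List.Relation.Unary.Unique.Propositional.Properties as UniqueP
import Data.List.Relation.Unary.Unique.DecPropositional.Properties as DecUniqueP
open import Data.Product using (Σ; ∃; _×_; _,_; proj₂)
open import Function.Base using (_∘_)
open import Function.Bundles using (_⇔_; mk⇔; Equivalence)
open import Relation.Binary.PropositionalEquality
open import Relation.Nullary using (Dec)
open import Relation.Nullary.Decidable using (_×-dec_)
open import Relation.Unary using (Decidable)

open import Algebra.Properties.Semiring.Sum ℤP.+-*-semiring
  using ( sum; sum-syntax; sum-replicate-zero; sum-cong-≗; ∑-distrib-+; ∑-comm
        ; *-distribˡ-sum; *-distribʳ-sum)
open import Algebra.Properties.AbelianGroup ℤP.+-0-abelianGroup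
  using (//-rightDividesˡ; //-rightDividesʳ)

open Equivalence using (to; from)
open ≡-Reasoning

ΣFin≡sum : ∀ {k} (f : Fin k → ℤ) → ΣFin f ≡ sum f
ΣFin≡sum {zero} f = refl
ΣFin≡sum {suc k} f = cong (_+_ (f zero)) (ΣFin≡sum (f ∘ suc))

sum-nonneg : ∀ {k} (f : Fin k → ℤ) → (∀ i → 0ℤ ≤ℤ f i) → 0ℤ ≤ℤ sum f
sum-nonneg {zero} f f≥0 = ℤP.≤-refl
sum-nonneg {suc k} f f≥0 = ℤP.+-mono-≤ (f≥0 zero) (sum-nonneg (f ∘ suc) (f≥0 ∘ suc))

term≤sum : ∀ {k} (f : Fin k → ℤ) → (∀ i → 0ℤ ≤ℤ f i) → ∀ i → f i ≤ℤ sum f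
term≤sum f f≥0 zero = subst (_≤ℤ sum f) (ℤP.+-identityʳ (f zero))
  (ℤP.+-monoʳ-≤ (f zero) (sum-nonneg (f ∘ suc) (f≥0 ∘ suc)))
term≤sum f f≥0 (suc i) = ℤP.≤-trans (term≤sum (f ∘ suc) (f≥0 ∘ suc) i)
  (subst (_≤ℤ sum f) (ℤP.+-identityˡ _) (ℤP.+-monoˡ-≤ _ (f≥0 zero)))

infixr 7 _·ᵥ_

_·ᵥ_ : ∀ {k} → Matrix k → (Fin k → ℤ) → Fin k → ℤ
_·ᵥ_ {k} M v i = ∑[ j < k ] (M i j * v j)

δ-·ᵥ : ∀ {k} (v : Fin k → ℤ) (i : Fin k) → (δ ·ᵥ v) i ≡ v i
δ-·ᵥ {suc k} v zero = begin
  1ℤ * v zero + ∑[ j < k ] 0ℤ  ≡⟨ cong (_+_ (1ℤ * v zero)) (sum-replicate-zero k) ⟩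
  1ℤ * v zero + 0ℤ             ≡⟨ ℤP.+-identityʳ _ ⟩
  1ℤ * v zero                  ≡⟨ ℤP.*-identityˡ _ ⟩
  v zero                       ∎
δ-·ᵥ {suc k} v (suc i) = trans (ℤP.+-identityˡ _) (δ-·ᵥ (v ∘ suc) i)

·ᵥ-+ : ∀ {k} (M : Matrix k) (u v : Fin k → ℤ) i →
  (M ·ᵥ (λ j → u j + v j)) i ≡ (M ·ᵥ u) i + (M ·ᵥ v) i
·ᵥ-+ M u v i = trans (sum-cong-≗ (λ j → ℤP.*-distribˡ-+ (M i j) (u j) (v j)))
                     (∑-distrib-+ (λ j → M i j * u j) (λ j → M i j * v j))

·-·ᵥ-assoc : ∀ {k} (M N : Matrix k) (v : Fin k → ℤ) i →
  ((M · N) ·ᵥ v) i ≡ (M ·ᵥ (N ·ᵥ v)) i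
·-·ᵥ-assoc {k} M N v i = begin
  ∑[ j < k ] ((M · N) i j * v j)
    ≡⟨ sum-cong-≗ (λ j → cong (_* v j) (ΣFin≡sum (λ l → M i l * N l j))) ⟩
  ∑[ j < k ] (∑[ l < k ] (M i l * N l j) * v j)
    ≡⟨ sum-cong-≗ (λ j → *-distribʳ-sum (v j) (λ l → M i l * N l j)) ⟩
  ∑[ j < k ] ∑[ l < k ] (M i l * N l j * v j)
    ≡⟨ ∑-comm (λ j l → M i l * N l j * v j) ⟩
  ∑[ l < k ] ∑[ j < k ] (M i l * N l j * v j)
    ≡⟨ sum-cong-≗ (λ l → sum-cong-≗ (λ j → ℤP.*-assoc (M i l) (N l j) (v j))) ⟩
  ∑[ l < k ] ∑[ j < k ] (M i l * (N l j * v j))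
    ≡⟨ sum-cong-≗ (λ l → sym (*-distribˡ-sum (M i l) (λ j → N l j * v j))) ⟩
  ∑[ l < k ] (M i l * (N ·ᵥ v) l)
    ∎

·ᵥ-rightInverse : ∀ {k} {M B : Matrix k} → (∀ i j → (M · B) i j ≡ δ i j) →
  ∀ v i → (M ·ᵥ (B ·ᵥ v)) i ≡ v i
·ᵥ-rightInverse {M = M} {B} MB≡I v i = begin
  (M ·ᵥ (B ·ᵥ v)) i  ≡⟨ sym (·-·ᵥ-assoc M B v i) ⟩
  ((M · B) ·ᵥ v) i   ≡⟨ sum-cong-≗ (λ j → cong (_* v j) (MB≡I i j)) ⟩
  (δ ·ᵥ v) i         ≡⟨ δ-·ᵥ v i ⟩
  v i                ∎

IminusA-·ᵥ : ∀ {k} (A : Matrix k) (v : Fin k → ℤ) i →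
  (IminusA A ·ᵥ v) i + (A ·ᵥ v) i ≡ v i
IminusA-·ᵥ {k} A v i = begin
  (IminusA A ·ᵥ v) i + (A ·ᵥ v) i
    ≡⟨ sym (∑-distrib-+ (λ j → (δ i j - A i j) * v j) (λ j → A i j * v j)) ⟩
  ∑[ j < k ] ((δ i j - A i j) * v j + A i j * v j)
    ≡⟨ sum-cong-≗ (λ j → sym (ℤP.*-distribʳ-+ (v j) (δ i j - A i j) (A i j))) ⟩
  ∑[ j < k ] ((δ i j - A i j + A i j) * v j)
    ≡⟨ sum-cong-≗ (λ j → cong (_* v j) (//-rightDividesˡ (A i j) (δ i j))) ⟩
  (δ ·ᵥ v) i
    ≡⟨ δ-·ᵥ v i ⟩
  v i ∎

sum-·ᵥ : ∀ {k} (B : Matrix k) (v : Fin k → ℤ) →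
  ∑[ i < k ] (B ·ᵥ v) i ≡ ∑[ j < k ] (v j * ∑[ i < k ] B i j)
sum-·ᵥ {k} B v = begin
  ∑[ i < k ] ∑[ j < k ] (B i j * v j)
    ≡⟨ ∑-comm (λ i j → B i j * v j) ⟩
  ∑[ j < k ] ∑[ i < k ] (B i j * v j)
    ≡⟨ sum-cong-≗ (λ j → sym (*-distribʳ-sum (v j) (λ i → B i j))) ⟩
  ∑[ j < k ] (∑[ i < k ] B i j * v j)
    ≡⟨ sum-cong-≗ (λ j → ℤP.*-comm (∑[ i < k ] B i j) (v j)) ⟩
  ∑[ j < k ] (v j * ∑[ i < k ] B i j)
    ∎

tailSum-upper : ∀ {k} {A : Matrix k} → StrictlyUpper A →
  ∀ l i → tailSum A l i ≡ (A ·ᵥ lookup l) i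
tailSum-upper {A = A} upper l i =
  trans (ΣFin≡sum (λ j → if toℕ i ℕ.<ᵇ toℕ j then A i j * lookup l j else 0ℤ))
        (sum-cong-≗ below-diagonal-vanishes)
  where
  below-diagonal-vanishes : ∀ j →
    (if toℕ i ℕ.<ᵇ toℕ j then A i j * lookup l j else 0ℤ) ≡ A i j * lookup l j
  below-diagonal-vanishes j with toℕ i ℕ.<ᵇ toℕ j in i<ᵇj
  ... | true  = refl
  ... | false = cong (_* lookup l j)
                  (sym (upper i j (ℕP.≮⇒≥ (λ i<j → subst T i<ᵇj (ℕP.<⇒<ᵇ i<j)))))

infixl 6 _+ᵛ_ _−ᵛ_

_+ᵛ_ : ∀ {k} → Vec ℤ k → Vec ℤ k → Vec ℤ k
_+ᵛ_ = zipWith _+_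

_−ᵛ_ : ∀ {k} → Vec ℤ k → Vec ℤ k → Vec ℤ k
_−ᵛ_ = zipWith _-_

+ᵛ-−ᵛ-cancel : ∀ {k} (u v : Vec ℤ k) → u +ᵛ v −ᵛ v ≡ u
+ᵛ-−ᵛ-cancel []      []      = refl
+ᵛ-−ᵛ-cancel (x ∷ u) (y ∷ v) = cong₂ _∷_ (//-rightDividesʳ y x) (+ᵛ-−ᵛ-cancel u v)

−ᵛ-+ᵛ-cancel : ∀ {k} (u v : Vec ℤ k) → u −ᵛ v +ᵛ v ≡ u
−ᵛ-+ᵛ-cancel []      []      = refl
−ᵛ-+ᵛ-cancel (x ∷ u) (y ∷ v) = cong₂ _∷_ (//-rightDividesˡ y x) (−ᵛ-+ᵛ-cancel u v)

weight-+ᵛ : ∀ {k} (u v : Vec ℤ k) → weight (u +ᵛ v) ≡ weight u + weight v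
weight-+ᵛ {k} u v = begin
  weight (u +ᵛ v)
    ≡⟨ ΣFin≡sum (lookup (u +ᵛ v)) ⟩
  ∑[ i < k ] lookup (u +ᵛ v) i
    ≡⟨ sum-cong-≗ (λ i → VecP.lookup-zipWith _+_ i u v) ⟩
  ∑[ i < k ] (lookup u i + lookup v i)
    ≡⟨ ∑-distrib-+ (lookup u) (lookup v) ⟩
  ∑[ i < k ] lookup u i + ∑[ i < k ] lookup v i
    ≡⟨ sym (cong₂ _+_ (ΣFin≡sum (lookup u)) (ΣFin≡sum (lookup v))) ⟩
  weight u + weight v
    ∎

tailSum-+ᵛ : ∀ {k} {A : Matrix k} → StrictlyUpper A →
  ∀ u v i → tailSum A (u +ᵛ v) i ≡ tailSum A u i + tailSum A v i
tailSum-+ᵛ {A = A} upper u v i = begin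
  tailSum A (u +ᵛ v) i                        ≡⟨ tailSum-upper upper (u +ᵛ v) i ⟩
  (A ·ᵥ lookup (u +ᵛ v)) i
    ≡⟨ sum-cong-≗ (λ j → cong (A i j *_) (VecP.lookup-zipWith _+_ j u v)) ⟩
  (A ·ᵥ (λ j → lookup u j + lookup v j)) i    ≡⟨ ·ᵥ-+ A (lookup u) (lookup v) i ⟩
  (A ·ᵥ lookup u) i + (A ·ᵥ lookup v) i
    ≡⟨ sym (cong₂ _+_ (tailSum-upper upper u i) (tailSum-upper upper v i)) ⟩
  tailSum A u i + tailSum A v i               ∎

Cond-+ : ∀ b {x y} e → Cond b x y → Cond b (x + e) (y + e)
Cond-+ true  e = cong (_+ e)
Cond-+ false e = ℤP.+-monoˡ-≤ e

Cond-+-⇔ : ∀ b {x y} e → Cond b x y ⇔ Cond b (x + e) (y + e)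
Cond-+-⇔ b {x} {y} e = mk⇔ (Cond-+ b e)
  (subst₂ (Cond b) (//-rightDividesʳ e x) (//-rightDividesʳ e y) ∘ Cond-+ b (- e))

Cond-+⇒≥ : ∀ b {x y} m → Cond b x (y + + m) → y ≤ℤ x
Cond-+⇒≥ true  {y = y} m x≡y+m = ℤP.≤-trans (ℤP.i≤i+j y (+ m)) (ℤP.≤-reflexive (sym x≡y+m))
Cond-+⇒≥ false {y = y} m y+m≤x = ℤP.≤-trans (ℤP.i≤i+j y (+ m)) y+m≤x

Cond? : ∀ b x y → Dec (Cond b x y)
Cond? true  x y = x ℤP.≟ y
Cond? false x y = y ℤP.≤? x

≡-⇔+≡ : ∀ x y z → x ≡ y - z ⇔ x + z ≡ y
≡-⇔+≡ x y z = mk⇔ (λ x≡y-z → trans (cong (_+ z) x≡y-z) (//-rightDividesˡ z y))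
                  (λ x+z≡y → trans (sym (//-rightDividesʳ z x)) (cong (_- z) x+z≡y))

SupersolutionsNonnegative : ∀ {k} → Matrix k → Set
SupersolutionsNonnegative {k} A =
  ∀ (l : Vec ℤ k) → (∀ i → tailSum A l i ≤ℤ lookup l i) → ∀ i → 0ℤ ≤ℤ lookup l i

solution : ∀ {k} → Matrix k → (Fin k → ℕ) → Vec ℤ k
solution B d = tabulate (B ·ᵥ (+_ ∘ d))

solution-satisfies : ∀ {k} {A B : Matrix k} → StrictlyUpper A → IsInverseOf B (IminusA A) →
  ∀ d i → lookup (solution B d) i ≡ tailSum A (solution B d) i + + d i
solution-satisfies {A = A} {B} upper (I-A·B≡I , _) d i = begin
  lookup c i                                 ≡⟨ VecP.lookup∘tabulate _ i ⟩
  (B ·ᵥ d′) i                                ≡⟨ sym (IminusA-·ᵥ A (B ·ᵥ d′) i) ⟩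
  (IminusA A ·ᵥ B ·ᵥ d′) i + (A ·ᵥ B ·ᵥ d′) i
    ≡⟨ cong₂ _+_ (·ᵥ-rightInverse {M = IminusA A} I-A·B≡I d′ i) A·c≡tailSum ⟩
  + d i + tailSum A c i                      ≡⟨ ℤP.+-comm (+ d i) (tailSum A c i) ⟩
  tailSum A c i + + d i                      ∎
  where
  c : Vec ℤ _
  c = solution B d
  d′ : Fin _ → ℤ
  d′ = +_ ∘ d
  A·c≡tailSum : (A ·ᵥ B ·ᵥ d′) i ≡ tailSum A c i
  A·c≡tailSum = trans (sum-cong-≗ (λ j → cong (A i j *_) (sym (VecP.lookup∘tabulate _ j))))
                      (sym (tailSum-upper upper c i))

weight-solution : ∀ {k} (B : Matrix k) d → weight (solution B d) ≡ shift d B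
weight-solution {k} B d = begin
  weight (solution B d)
    ≡⟨ ΣFin≡sum (lookup (solution B d)) ⟩
  ∑[ i < k ] lookup (solution B d) i
    ≡⟨ sum-cong-≗ (VecP.lookup∘tabulate (B ·ᵥ (+_ ∘ d))) ⟩
  ∑[ i < k ] (B ·ᵥ (+_ ∘ d)) i
    ≡⟨ sum-·ᵥ B (+_ ∘ d) ⟩
  ∑[ j < k ] (+ d j * ∑[ i < k ] B i j)
    ≡⟨ sum-cong-≗ (λ j → cong (+ d j *_) (ΣFin≡sum (λ i → B i j))) ⟨
  ∑[ j < k ] (+ d j * colSum B j)
    ≡⟨ ΣFin≡sum (λ j → + d j * colSum B j) ⟨
  shift d B
    ∎

module _ {k} {A : Matrix k} (upper : StrictlyUpper A) (nonneg : SupersolutionsNonnegative A)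
         (S : Subset k) (d : Fin k → ℕ) (c : Vec ℤ k)
         (c-satisfies : ∀ i → lookup c i ≡ tailSum A c i + + d i) where

  Cond-translate : ∀ μ i →
    Cond (lookup S i) (lookup μ i) (tailSum A μ i) ⇔
    Cond (lookup S i) (lookup (μ +ᵛ c) i) (tailSum A (μ +ᵛ c) i + + d i)
  Cond-translate μ i =
    subst₂ (λ x y → Cond b (lookup μ i) (tailSum A μ i) ⇔ Cond b x y)
           (sym (VecP.lookup-zipWith _+_ i μ c)) tailSum-shift (Cond-+-⇔ b (lookup c i))
    where
    b : Bool
    b = lookup S i
    tailSum-shift : tailSum A μ i + lookup c i ≡ tailSum A (μ +ᵛ c) i + + d i
    tailSum-shift = begin
      tailSum A μ i + lookup c i                       ≡⟨ cong (_+_ (tailSum A μ i)) (c-satisfies i) ⟩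
      tailSum A μ i + (tailSum A c i + + d i)          ≡⟨ ℤP.+-assoc (tailSum A μ i) _ _ ⟨
      tailSum A μ i + tailSum A c i + + d i            ≡⟨ cong (_+ + d i) (tailSum-+ᵛ upper μ c i) ⟨
      tailSum A (μ +ᵛ c) i + + d i                     ∎

  InP⇔InD-translate : ∀ n μ → InP A S (+ n - weight c) μ ⇔ InD A S d n (μ +ᵛ c)
  InP⇔InD-translate n μ = mk⇔ P⇒D D⇒P
    where
    weight-⇔ : weight μ ≡ + n - weight c ⇔ weight (μ +ᵛ c) ≡ + n
    weight-⇔ = subst (λ w → weight μ ≡ + n - weight c ⇔ w ≡ + n) (sym (weight-+ᵛ μ c))
                     (≡-⇔+≡ (weight μ) (+ n) (weight c))

    P⇒D : InP A S (+ n - weight c) μ → InD A S d n (μ +ᵛ c)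
    P⇒D (weight-μ , conds) = to weight-⇔ weight-μ , nonneg (μ +ᵛ c) dominated , conds′
      where
      conds′ : ∀ i → Cond (lookup S i) (lookup (μ +ᵛ c) i) (tailSum A (μ +ᵛ c) i + + d i)
      conds′ i = to (Cond-translate μ i) (conds i)
      dominated : ∀ i → tailSum A (μ +ᵛ c) i ≤ℤ lookup (μ +ᵛ c) i
      dominated i = Cond-+⇒≥ (lookup S i) (d i) (conds′ i)

    D⇒P : InD A S d n (μ +ᵛ c) → InP A S (+ n - weight c) μ
    D⇒P (weight-μ+c , _ , conds) =
      from weight-⇔ weight-μ+c , λ i → from (Cond-translate μ i) (conds i)

HasCard-reindex : ∀ {k} {P Q : Vec ℤ k → Set} {m} (f g : Vec ℤ k → Vec ℤ k) →
  (∀ v → g (f v) ≡ v) → (∀ w → f (g w) ≡ w) → (∀ v → P v ⇔ Q (f v)) →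
  HasCard Q m → HasCard P m
HasCard-reindex {P = P} {Q} f g g∘f≡id f∘g≡id P⇔Q∘f (xs , length≡m , unique , Q⇔∈xs) =
  map g xs , trans (ListP.length-map g xs) length≡m , UniqueP.map⁺ g-injective unique ,
  λ v → mk⇔ (λ Pv → subst (_∈ map g xs) (g∘f≡id v)
                          (∈-map⁺ g (to (Q⇔∈xs (f v)) (to (P⇔Q∘f v) Pv))))
            (λ v∈ → let (w , w∈xs , v≡gw) = ∈-map⁻ g v∈ in
                    subst P (sym v≡gw)
                      (from (P⇔Q∘f (g w)) (subst Q (sym (f∘g≡id w)) (from (Q⇔∈xs w) w∈xs))))
  where
  g-injective : ∀ {w w′} → g w ≡ g w′ → w ≡ w′
  g-injective {w} {w′} gw≡gw′ = trans (sym (f∘g≡id w)) (trans (cong f gw≡gw′) (f∘g≡id w′))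

_≟ᵛ_ : ∀ {k} → (u v : Vec ℤ k) → Dec (u ≡ v)
_≟ᵛ_ = VecP.≡-dec ℤP._≟_

HasCard-⊆ : ∀ {k} {P : Vec ℤ k → Set} → Decidable P →
  (xs : List (Vec ℤ k)) → (∀ v → P v → v ∈ xs) → ∃ (HasCard P)
HasCard-⊆ P? xs P⊆xs =
  length ys , ys , refl , DecUniqueP.deduplicate-! _≟ᵛ_ (filter P? xs) ,
  λ v → mk⇔ (λ Pv → ∈-deduplicate⁺ _≟ᵛ_ (∈-filter⁺ P? {v} {xs} (P⊆xs v Pv) Pv))
            (λ v∈ys → proj₂ (∈-filter⁻ P? {v} {xs}
                               (∈-deduplicate⁻ _≟ᵛ_ (filter P? xs) v∈ys)))
  where
  ys : List (Vec ℤ _)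
  ys = deduplicate _≟ᵛ_ (filter P? xs)

box : ∀ k → ℕ → List (Vec ℤ k)
box zero    n = List.[ [] ]
box (suc k) n = cartesianProductWith _∷_ (map +_ (upTo (suc n))) (box k n)

∈-box : ∀ {k} n (v : Vec ℤ k) → (∀ i → 0ℤ ≤ℤ lookup v i) → (∀ i → lookup v i ≤ℤ + n) →
  v ∈ box k n
∈-box n []             _   _   = here refl
∈-box n (+ m ∷ v)      v≥0 v≤n with v≤n zero
... | +≤+ m≤n = ∈-cartesianProductWith⁺ _∷_ (∈-map⁺ +_ (∈-upTo⁺ (s≤s m≤n)))
                                              (∈-box n v (v≥0 ∘ suc) (v≤n ∘ suc))
∈-box n (-[1+ m ] ∷ v) v≥0 _   with v≥0 zero
... | ()

module _ {k} (A : Matrix k) (S : Subset k) (d : Fin k → ℕ) (n : ℕ) where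

  InD? : Decidable (InD A S d n)
  InD? v = (weight v ℤP.≟ + n)
     ×-dec FinP.all? (λ i → 0ℤ ℤP.≤? lookup v i)
     ×-dec FinP.all? (λ i → Cond? (lookup S i) (lookup v i) (tailSum A v i + + d i))

  InD⊆box : ∀ v → InD A S d n v → v ∈ box k n
  InD⊆box v (weight≡n , v≥0 , _) = ∈-box n v v≥0 λ i →
    subst (lookup v i ≤ℤ_) (trans (sym (ΣFin≡sum (lookup v))) weight≡n)
          (term≤sum (lookup v) v≥0 i)

  InD-finite : ∃ (HasCard (InD A S d n))
  InD-finite = HasCard-⊆ InD? (box k n) InD⊆box

corollary3 : (k : ℕ) → 1 ≤ k → (A : Matrix k) → StrictlyUpper A
    → (∀ (l : Vec ℤ k) → (∀ i → tailSum A l i ≤ℤ lookup l i) → ∀ i → 0ℤ ≤ℤ lookup l i)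
    → (S : Subset k) → (d : Fin k → ℕ)
    → (B : Matrix k) → IsInverseOf B (IminusA A)
    → (n : ℕ)
    → Σ ℕ (λ m → HasCard (InD A S d n) m × HasCard (InP A S (+ n - shift d B)) m)
corollary3 k _ A upper nonneg S d B inverse n =
  let m , D-card = InD-finite A S d n in
  m , D-card , HasCard-reindex (_+ᵛ c) (_−ᵛ c) (λ v → +ᵛ-−ᵛ-cancel v c)
                                (λ v → −ᵛ-+ᵛ-cancel v c) P⇔D-translate D-card
  where
  c : Vec ℤ k
  c = solution B d
  P⇔D-translate : ∀ μ → InP A S (+ n - shift d B) μ ⇔ InD A S d n (μ +ᵛ c)
  P⇔D-translate μ =
    subst (λ w → InP A S (+ n - w) μ ⇔ InD A S d n (μ +ᵛ c)) (weight-solution B d)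
          (InP⇔InD-translate upper nonneg S d c (solution-satisfies upper inverse d) n μ)
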